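{- Let $\alpha,\beta:\mathbb{Q}_+^5\to\mathbb{Q}_+^5$ be $$\alpha(a,b,c,d,e)=\Big(b,\tfrac{b^2+cd}{a},c,d,e\Big),\qquad \beta(a,b,c,d,e)=\Big(b,c,\tfrac{ac+be}{d},a,e\Big),$$ and $\tilde\alpha,\tilde\beta:\mathbb{Q}^3\to\mathbb{Q}^3$ be $\tilde\alpha(x,y,z)=(x,z,xz-y)$, $\tilde\beta(x,y,z)=(y,z,x)$ (all four are bijections). Let $\varphi:\mathbb{Q}_+^5\to\mathbb{Q}_+^3$ be $\varphi(a,b,c,d,e)=(\mathcal{C}_0,\mathcal{C}_1,\mathcal{C}_2)$ with $$\mathcal{C}_0=\frac{a^2+b^2+cd}{ab},\quad \mathcal{C}_1=\frac{c^2d+a^2c+b^2d+abe}{bcd},\quad \mathcal{C}_2=\frac{cd^2+a^2c+b^2d+abe}{acd}.$$ Let $P\in\mathbb{Q}_+^5$, let $t\ge 1$ and $n_1,m_1,\dots,n_t,m_t\in\mathbb{Z}$, and set $g=\alpha^{n_1}\beta^{m_1}\cdots\alpha^{n_t}\beta^{m_t}$ and $\tilde g=\tilde\alpha^{n_1}\tilde\beta^{m_1}\cdots\tilde\alpha^{n_t}\tilde\beta^{m_t}$. Then $$\varphi(g(P))=\tilde g(\varphi(P)).$$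
   Context: $\mathbb{Q}_+$ denotes the positive rationals. -}

module Defs where

open import Data.Nat using (ℕ; zero; suc)
open import Data.Integer using (ℤ; +_; -[1+_])
open import Data.Rational using (ℚ; Positive; _+_; _*_; _-_; 1/_; _÷_)
open import Data.Rational.Properties using (pos⇒nonZero; pos+pos⇒pos; pos*pos⇒pos; 1/pos⇒pos)
open import Data.Product using (_×_; _,_)
open import Data.Vec using (Vec; []; _∷_)
open import Function using (id; _∘_)

record ℚ₊ : Set where
  constructor ⟨_⟩₊
  field
    val : ℚ
    .{{pos}} : Positive val
open ℚ₊ public

infixl 6 _+₊_
infixl 7 _*₊_ _÷₊_

_+₊_ : ℚ₊ → ℚ₊ → ℚ₊
⟨ p ⟩₊ +₊ ⟨ q ⟩₊ = record { val = p + q ; pos = pos+pos⇒pos p q }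

_*₊_ : ℚ₊ → ℚ₊ → ℚ₊
⟨ p ⟩₊ *₊ ⟨ q ⟩₊ = record { val = p * q ; pos = pos*pos⇒pos p q }

_÷₊_ : ℚ₊ → ℚ₊ → ℚ₊
⟨ p ⟩₊ ÷₊ ⟨ q ⟩₊ = record
  { val = (p ÷ q) {{pos⇒nonZero q}}
  ; pos = pos*pos⇒pos p ((1/ q) {{pos⇒nonZero q}}) {{1/pos⇒pos q}} }

Q5 : Set
Q5 = ℚ₊ × ℚ₊ × ℚ₊ × ℚ₊ × ℚ₊

Q3 : Set
Q3 = ℚ × ℚ × ℚ

α : Q5 → Q5
α (a , b , c , d , e) = (b , (b *₊ b +₊ c *₊ d) ÷₊ a , c , d , e)

α⁻¹ : Q5 → Q5
α⁻¹ (a , b , c , d , e) = ((a *₊ a +₊ c *₊ d) ÷₊ b , a , c , d , e)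

β : Q5 → Q5
β (a , b , c , d , e) = (b , c , (a *₊ c +₊ b *₊ e) ÷₊ d , a , e)

β⁻¹ : Q5 → Q5
β⁻¹ (a , b , c , d , e) = (d , a , b , (b *₊ d +₊ a *₊ e) ÷₊ c , e)

α̃ : Q3 → Q3
α̃ (x , y , z) = (x , z , x * z - y)

α̃⁻¹ : Q3 → Q3
α̃⁻¹ (x , y , z) = (x , x * y - z , y)

β̃ : Q3 → Q3
β̃ (x , y , z) = (y , z , x)

β̃⁻¹ : Q3 → Q3
β̃⁻¹ (x , y , z) = (z , x , y)

iter : {A : Set} → (A → A) → ℕ → A → A
iter f zero = id
iter f (suc k) = f ∘ iter f k

zpow : {A : Set} → (A → A) → (A → A) → ℤ → A → A
zpow f f⁻¹ (+ k) = iter f k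
zpow f f⁻¹ -[1+ k ] = iter f⁻¹ (suc k)

g : {t : ℕ} → Vec ℤ t → Vec ℤ t → Q5 → Q5
g [] [] = id
g (n ∷ ns) (m ∷ ms) = zpow α α⁻¹ n ∘ zpow β β⁻¹ m ∘ g ns ms

g̃ : {t : ℕ} → Vec ℤ t → Vec ℤ t → Q3 → Q3
g̃ [] [] = id
g̃ (n ∷ ns) (m ∷ ms) = zpow α̃ α̃⁻¹ n ∘ zpow β̃ β̃⁻¹ m ∘ g̃ ns ms

C₀ C₁ C₂ : Q5 → ℚ₊
C₀ (a , b , c , d , e) = (a *₊ a +₊ b *₊ b +₊ c *₊ d) ÷₊ (a *₊ b)
C₁ (a , b , c , d , e) =
  (c *₊ c *₊ d +₊ a *₊ a *₊ c +₊ b *₊ b *₊ d +₊ a *₊ b *₊ e) ÷₊ (b *₊ c *₊ d)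
C₂ (a , b , c , d , e) =
  (c *₊ d *₊ d +₊ a *₊ a *₊ c +₊ b *₊ b *₊ d +₊ a *₊ b *₊ e) ÷₊ (a *₊ c *₊ d)

φ : Q5 → Q3
φ P = (val (C₀ P) , val (C₁ P) , val (C₂ P))

{-# OPTIONS --safe #-}
-- It suffices to check φ ∘ α = α̃ ∘ φ and φ ∘ β = β̃ ∘ φ: the inverses then commute with φ
-- formally (α α⁻¹ = id and α̃⁻¹ α̃ = id, likewise for β), hence so do all integer powers and
-- every word g. For the generators, clear denominators: the one new coordinate v of α P
-- (resp. w of β P) enters only through v a = b² + c d (resp. w d = a c + b e), so each of
-- the six component identities is a polynomial identity modulo that relation.
module Submission where

open import Defs
open import Data.Nat using (ℕ; _≤_; zero; suc)
open import Data.Integer using (ℤ; +_; -[1+_])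
open import Data.Vec as Vec using (Vec)
open import Data.List using (_∷_; [])
open import Data.Maybe using (Maybe; just; nothing)
open import Data.Product using (_,_)
open import Data.Rational using (ℚ; 0ℚ; 1ℚ; _≟_; _+_; _*_; -_; _-_; 1/_; NonZero)
open import Data.Rational.Properties
  using (+-*-commutativeRing; *-comm; *-assoc; *-identityʳ; *-inverseˡ; *-inverseʳ; *-zeroˡ; +-inverseʳ; +-identityʳ; pos⇒nonZero)
open import Function using (id; _∘_)
open import Level using (0ℓ)
open import Relation.Nullary using (yes; no)
open import Relation.Binary.PropositionalEquality
  using (_≡_; _≗_; refl; sym; trans; cong; cong₂; module ≡-Reasoning)
open import Tactic.RingSolver using (solve)
open import Tactic.RingSolver.Core.AlmostCommutativeRing using (AlmostCommutativeRing; fromCommutativeRing)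

open ≡-Reasoning

ℚ-ring : AlmostCommutativeRing 0ℓ 0ℓ
ℚ-ring = fromCommutativeRing +-*-commutativeRing is-zero
  where
  is-zero : (x : ℚ) → Maybe (0ℚ ≡ x)
  is-zero x with 0ℚ ≟ x
  ... | yes 0≡x = just 0≡x
  ... | no _    = nothing

*-cancelʳ-≡ : ∀ {x y} k .{{_ : NonZero k}} → x * k ≡ y * k → x ≡ y
*-cancelʳ-≡ {x} {y} k xk≡yk = begin
  x                ≡⟨ sym (*-identityʳ x) ⟩
  x * 1ℚ           ≡⟨ cong (x *_) (sym (*-inverseʳ k)) ⟩
  x * (k * 1/ k)   ≡⟨ sym (*-assoc x k (1/ k)) ⟩
  x * k * 1/ k     ≡⟨ cong (_* 1/ k) xk≡yk ⟩
  y * k * 1/ k     ≡⟨ *-assoc y k (1/ k) ⟩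
  y * (k * 1/ k)   ≡⟨ cong (y *_) (*-inverseʳ k) ⟩
  y * 1ℚ           ≡⟨ *-identityʳ y ⟩
  y                ∎

≡-modulo : ∀ {x y r s} q → r ≡ s → x ≡ y + (r - s) * q → x ≡ y
≡-modulo {x} {y} {r} q refl x≡y+0 = begin
  x                ≡⟨ x≡y+0 ⟩
  y + (r - r) * q  ≡⟨ cong (λ z → y + z * q) (+-inverseʳ r) ⟩
  y + 0ℚ * q       ≡⟨ cong (λ z → y + z) (*-zeroˡ q) ⟩
  y + 0ℚ           ≡⟨ +-identityʳ y ⟩
  y                ∎

val-injective : {p q : ℚ₊} → val p ≡ val q → p ≡ q
val-injective {⟨ p ⟩₊} {⟨ .p ⟩₊} refl = refl

÷₊-*-cancel : (p q : ℚ₊) → val (p ÷₊ q) * val q ≡ val p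
÷₊-*-cancel ⟨ p ⟩₊ ⟨ q ⟩₊ = begin
  p * 1/ q * q     ≡⟨ *-assoc p (1/ q) q ⟩
  p * (1/ q * q)   ≡⟨ cong (p *_) (*-inverseˡ q) ⟩
  p * 1ℚ           ≡⟨ *-identityʳ p ⟩
  p                ∎
  where instance _ = pos⇒nonZero q

nonZero : (p : ℚ₊) → NonZero (val p)
nonZero ⟨ p ⟩₊ = pos⇒nonZero p

÷₊-≡ : (n d : ℚ₊) {y : ℚ} → val n ≡ y * val d → val (n ÷₊ d) ≡ y
÷₊-≡ n d n≡yd = *-cancelʳ-≡ (val d) {{nonZero d}} (trans (÷₊-*-cancel n d) n≡yd)

÷₊-≡-scaled : (n d k : ℚ₊) {y : ℚ} → val n * val k ≡ y * (val d * val k) → val (n ÷₊ d) ≡ y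
÷₊-≡-scaled n d k {y} nk≡ydk =
  ÷₊-≡ n d (*-cancelʳ-≡ (val k) {{nonZero k}} (trans nk≡ydk (sym (*-assoc y (val d) (val k)))))

÷₊-÷₊ : (n m d : ℚ₊) → val n ≡ val m → val (n ÷₊ (m ÷₊ d)) ≡ val d
÷₊-÷₊ n m d n≡m = ÷₊-≡ n (m ÷₊ d) (begin
  val n                ≡⟨ n≡m ⟩
  val m                ≡⟨ sym (÷₊-*-cancel m d) ⟩
  val (m ÷₊ d) * val d ≡⟨ *-comm (val (m ÷₊ d)) (val d) ⟩
  val d * val (m ÷₊ d) ∎)

C₀-α-cleared : ∀ a b c d v c₀ → v * a ≡ b * b + c * d → c₀ * (a * b) ≡ a * a + b * b + c * d →
               (b * b + v * v + c * d) * a ≡ c₀ * (b * v * a)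
C₀-α-cleared a b c d v c₀ va≡bb+cd h₀ = begin
  (b * b + v * v + c * d) * a   ≡⟨ ≡-modulo (v - a) va≡bb+cd (solve (a ∷ b ∷ c ∷ d ∷ v ∷ []) ℚ-ring) ⟩
  (a * a + b * b + c * d) * v   ≡⟨ cong (_* v) (sym h₀) ⟩
  c₀ * (a * b) * v              ≡⟨ solve (a ∷ b ∷ v ∷ c₀ ∷ []) ℚ-ring ⟩
  c₀ * (b * v * a)              ∎

C₁-α-cleared : ∀ a b c d e v c₂ → v * a ≡ b * b + c * d →
               c₂ * (a * c * d) ≡ c * d * d + a * a * c + b * b * d + a * b * e →
               (c * c * d + b * b * c + v * v * d + b * v * e) * a ≡ c₂ * (v * c * d * a)
C₁-α-cleared a b c d e v c₂ va≡bb+cd h₂ = begin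
  (c * c * d + b * b * c + v * v * d + b * v * e) * a
    ≡⟨ ≡-modulo (v * d - a * c) va≡bb+cd (solve (a ∷ b ∷ c ∷ d ∷ e ∷ v ∷ []) ℚ-ring) ⟩
  (c * d * d + a * a * c + b * b * d + a * b * e) * v
    ≡⟨ cong (_* v) (sym h₂) ⟩
  c₂ * (a * c * d) * v
    ≡⟨ solve (a ∷ c ∷ d ∷ v ∷ c₂ ∷ []) ℚ-ring ⟩
  c₂ * (v * c * d * a) ∎

C₂-α-cleared : ∀ a b c d e v c₀ c₁ c₂ → v * a ≡ b * b + c * d →
               c₀ * (a * b) ≡ a * a + b * b + c * d →
               c₁ * (b * c * d) ≡ c * c * d + a * a * c + b * b * d + a * b * e →
               c₂ * (a * c * d) ≡ c * d * d + a * a * c + b * b * d + a * b * e →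
               (c * d * d + b * b * c + v * v * d + b * v * e) * (a * a) ≡ (c₀ * c₂ - c₁) * (b * c * d * (a * a))
C₂-α-cleared a b c d e v c₀ c₁ c₂ va≡bb+cd h₀ h₁ h₂ = begin
  (c * d * d + b * b * c + v * v * d + b * v * e) * (a * a)
    ≡⟨ ≡-modulo (d * (a * v + (b * b + c * d)) + a * b * e) va≡bb+cd
                (solve (a ∷ b ∷ c ∷ d ∷ e ∷ v ∷ []) ℚ-ring) ⟩
  (a * a + b * b + c * d) * (c * d * d + a * a * c + b * b * d + a * b * e)
    - (c * c * d + a * a * c + b * b * d + a * b * e) * (a * a)
    ≡⟨ cong₂ (λ x y → x - y * (a * a)) (cong₂ _*_ (sym h₀) (sym h₂)) (sym h₁) ⟩
  c₀ * (a * b) * (c₂ * (a * c * d)) - c₁ * (b * c * d) * (a * a)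
    ≡⟨ solve (a ∷ b ∷ c ∷ d ∷ c₀ ∷ c₁ ∷ c₂ ∷ []) ℚ-ring ⟩
  (c₀ * c₂ - c₁) * (b * c * d * (a * a)) ∎

C₀-β-cleared : ∀ a b c d e w c₁ → w * d ≡ a * c + b * e →
               c₁ * (b * c * d) ≡ c * c * d + a * a * c + b * b * d + a * b * e →
               (b * b + c * c + w * a) * d ≡ c₁ * (b * c * d)
C₀-β-cleared a b c d e w c₁ wd≡ac+be h₁ = begin
  (b * b + c * c + w * a) * d
    ≡⟨ ≡-modulo a wd≡ac+be (solve (a ∷ b ∷ c ∷ d ∷ e ∷ w ∷ []) ℚ-ring) ⟩
  c * c * d + a * a * c + b * b * d + a * b * e
    ≡⟨ sym h₁ ⟩
  c₁ * (b * c * d) ∎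

C₁-β-cleared : ∀ a b c d e w c₂ → w * d ≡ a * c + b * e →
               c₂ * (a * c * d) ≡ c * d * d + a * a * c + b * b * d + a * b * e →
               (w * w * a + b * b * w + c * c * a + b * c * e) * d ≡ c₂ * (c * w * a * d)
C₁-β-cleared a b c d e w c₂ wd≡ac+be h₂ = begin
  (w * w * a + b * b * w + c * c * a + b * c * e) * d
    ≡⟨ ≡-modulo (a * w - c * d) wd≡ac+be (solve (a ∷ b ∷ c ∷ d ∷ e ∷ w ∷ []) ℚ-ring) ⟩
  (c * d * d + a * a * c + b * b * d + a * b * e) * w
    ≡⟨ cong (_* w) (sym h₂) ⟩
  c₂ * (a * c * d) * w
    ≡⟨ solve (a ∷ c ∷ d ∷ w ∷ c₂ ∷ []) ℚ-ring ⟩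
  c₂ * (c * w * a * d) ∎

C₂-β-cleared : ∀ a b c d e w c₀ → w * d ≡ a * c + b * e →
               c₀ * (a * b) ≡ a * a + b * b + c * d →
               w * a * a + b * b * w + c * c * a + b * c * e ≡ c₀ * (b * w * a)
C₂-β-cleared a b c d e w c₀ wd≡ac+be h₀ = begin
  w * a * a + b * b * w + c * c * a + b * c * e
    ≡⟨ ≡-modulo (- c) wd≡ac+be (solve (a ∷ b ∷ c ∷ d ∷ e ∷ w ∷ []) ℚ-ring) ⟩
  (a * a + b * b + c * d) * w
    ≡⟨ cong (_* w) (sym h₀) ⟩
  c₀ * (a * b) * w
    ≡⟨ solve (a ∷ b ∷ w ∷ c₀ ∷ []) ℚ-ring ⟩
  c₀ * (b * w * a) ∎

module _ (a b c d e : ℚ₊) where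
  private
    P : Q5
    P = a , b , c , d , e

    v w : ℚ₊
    v = (b *₊ b +₊ c *₊ d) ÷₊ a
    w = (a *₊ c +₊ b *₊ e) ÷₊ d

    v-relation : val v * val a ≡ val b * val b + val c * val d
    v-relation = ÷₊-*-cancel (b *₊ b +₊ c *₊ d) a

    w-relation : val w * val d ≡ val a * val c + val b * val e
    w-relation = ÷₊-*-cancel (a *₊ c +₊ b *₊ e) d

    C₀-numerator : val (C₀ P) * (val a * val b) ≡ val a * val a + val b * val b + val c * val d
    C₀-numerator = ÷₊-*-cancel (a *₊ a +₊ b *₊ b +₊ c *₊ d) (a *₊ b)

    C₁-numerator : val (C₁ P) * (val b * val c * val d)
                 ≡ val c * val c * val d + val a * val a * val c + val b * val b * val d + val a * val b * val e
    C₁-numerator = ÷₊-*-cancel (c *₊ c *₊ d +₊ a *₊ a *₊ c +₊ b *₊ b *₊ d +₊ a *₊ b *₊ e) (b *₊ c *₊ d)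

    C₂-numerator : val (C₂ P) * (val a * val c * val d)
                 ≡ val c * val d * val d + val a * val a * val c + val b * val b * val d + val a * val b * val e
    C₂-numerator = ÷₊-*-cancel (c *₊ d *₊ d +₊ a *₊ a *₊ c +₊ b *₊ b *₊ d +₊ a *₊ b *₊ e) (a *₊ c *₊ d)

  φ-α : φ (α P) ≡ α̃ (φ P)
  φ-α = cong₂ _,_ C₀-α (cong₂ _,_ C₁-α C₂-α)
    where
    C₀-α : val (C₀ (α P)) ≡ val (C₀ P)
    C₀-α = ÷₊-≡-scaled (b *₊ b +₊ v *₊ v +₊ c *₊ d) (b *₊ v) a
      (C₀-α-cleared (val a) (val b) (val c) (val d) (val v) (val (C₀ P)) v-relation C₀-numerator)

    C₁-α : val (C₁ (α P)) ≡ val (C₂ P)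
    C₁-α = ÷₊-≡-scaled (c *₊ c *₊ d +₊ b *₊ b *₊ c +₊ v *₊ v *₊ d +₊ b *₊ v *₊ e) (v *₊ c *₊ d) a
      (C₁-α-cleared (val a) (val b) (val c) (val d) (val e) (val v) (val (C₂ P)) v-relation C₂-numerator)

    C₂-α : val (C₂ (α P)) ≡ val (C₀ P) * val (C₂ P) - val (C₁ P)
    C₂-α = ÷₊-≡-scaled (c *₊ d *₊ d +₊ b *₊ b *₊ c +₊ v *₊ v *₊ d +₊ b *₊ v *₊ e) (b *₊ c *₊ d) (a *₊ a)
      (C₂-α-cleared (val a) (val b) (val c) (val d) (val e) (val v) (val (C₀ P)) (val (C₁ P)) (val (C₂ P))
                    v-relation C₀-numerator C₁-numerator C₂-numerator)

  φ-β : φ (β P) ≡ β̃ (φ P)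
  φ-β = cong₂ _,_ C₀-β (cong₂ _,_ C₁-β C₂-β)
    where
    C₀-β : val (C₀ (β P)) ≡ val (C₁ P)
    C₀-β = ÷₊-≡-scaled (b *₊ b +₊ c *₊ c +₊ w *₊ a) (b *₊ c) d
      (C₀-β-cleared (val a) (val b) (val c) (val d) (val e) (val w) (val (C₁ P)) w-relation C₁-numerator)

    C₁-β : val (C₁ (β P)) ≡ val (C₂ P)
    C₁-β = ÷₊-≡-scaled (w *₊ w *₊ a +₊ b *₊ b *₊ w +₊ c *₊ c *₊ a +₊ b *₊ c *₊ e) (c *₊ w *₊ a) d
      (C₁-β-cleared (val a) (val b) (val c) (val d) (val e) (val w) (val (C₂ P)) w-relation C₂-numerator)

    C₂-β : val (C₂ (β P)) ≡ val (C₀ P)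
    C₂-β = ÷₊-≡ (w *₊ a *₊ a +₊ b *₊ b *₊ w +₊ c *₊ c *₊ a +₊ b *₊ c *₊ e) (b *₊ w *₊ a)
      (C₂-β-cleared (val a) (val b) (val c) (val d) (val e) (val w) (val (C₀ P)) w-relation C₀-numerator)

φ∘α≗α̃∘φ : φ ∘ α ≗ α̃ ∘ φ
φ∘α≗α̃∘φ (a , b , c , d , e) = φ-α a b c d e

φ∘β≗β̃∘φ : φ ∘ β ≗ β̃ ∘ φ
φ∘β≗β̃∘φ (a , b , c , d , e) = φ-β a b c d e

α∘α⁻¹≗id : α ∘ α⁻¹ ≗ id
α∘α⁻¹≗id (a , b , c , d , e) =
  cong (λ z → a , z , c , d , e) (val-injective (÷₊-÷₊ (a *₊ a +₊ c *₊ d) (a *₊ a +₊ c *₊ d) b refl))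

β∘β⁻¹≗id : β ∘ β⁻¹ ≗ id
β∘β⁻¹≗id (a , b , c , d , e) =
  cong (λ z → a , b , z , d , e)
       (val-injective (÷₊-÷₊ (d *₊ b +₊ a *₊ e) (b *₊ d +₊ a *₊ e) c
                             (cong (_+ val a * val e) (*-comm (val d) (val b)))))

α̃⁻¹∘α̃≗id : α̃⁻¹ ∘ α̃ ≗ id
α̃⁻¹∘α̃≗id (x , y , z) = cong (λ u → x , u , z) xz-[xz-y]≡y
  where
  xz-[xz-y]≡y : x * z - (x * z - y) ≡ y
  xz-[xz-y]≡y = solve (x ∷ y ∷ z ∷ []) ℚ-ring

β̃⁻¹∘β̃≗id : β̃⁻¹ ∘ β̃ ≗ id
β̃⁻¹∘β̃≗id _ = refl

module _ {A B : Set} (h : A → B) where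

  iter-commute : ∀ {f F} → h ∘ f ≗ F ∘ h → ∀ k → h ∘ iter f k ≗ iter F k ∘ h
  iter-commute         h∘f≗F∘h zero    x = refl
  iter-commute {f} {F} h∘f≗F∘h (suc k) x =
    trans (h∘f≗F∘h (iter f k x)) (cong F (iter-commute h∘f≗F∘h k x))

  inverse-commute : ∀ {f f⁻¹ F F⁻¹} → h ∘ f ≗ F ∘ h → f ∘ f⁻¹ ≗ id → F⁻¹ ∘ F ≗ id →
                    h ∘ f⁻¹ ≗ F⁻¹ ∘ h
  inverse-commute {f} {f⁻¹} {F} {F⁻¹} h∘f≗F∘h f∘f⁻¹≗id F⁻¹∘F≗id x = begin
    h (f⁻¹ x)           ≡⟨ sym (F⁻¹∘F≗id _) ⟩
    F⁻¹ (F (h (f⁻¹ x))) ≡⟨ cong F⁻¹ (sym (h∘f≗F∘h _)) ⟩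
    F⁻¹ (h (f (f⁻¹ x))) ≡⟨ cong (F⁻¹ ∘ h) (f∘f⁻¹≗id x) ⟩
    F⁻¹ (h x)           ∎

  zpow-commute : ∀ {f f⁻¹ F F⁻¹} → h ∘ f ≗ F ∘ h → f ∘ f⁻¹ ≗ id → F⁻¹ ∘ F ≗ id →
                 ∀ n → h ∘ zpow f f⁻¹ n ≗ zpow F F⁻¹ n ∘ h
  zpow-commute h∘f≗F∘h _ _ (+ k) = iter-commute h∘f≗F∘h k
  zpow-commute {f} {f⁻¹} {F} {F⁻¹} h∘f≗F∘h f∘f⁻¹≗id F⁻¹∘F≗id -[1+ k ] =
    iter-commute {f⁻¹} {F⁻¹} (inverse-commute {f} {f⁻¹} {F} {F⁻¹} h∘f≗F∘h f∘f⁻¹≗id F⁻¹∘F≗id) (suc k)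

φ∘g≗g̃∘φ : ∀ {t} (ns ms : Vec ℤ t) → φ ∘ g ns ms ≗ g̃ ns ms ∘ φ
φ∘g≗g̃∘φ Vec.[] Vec.[] P = refl
φ∘g≗g̃∘φ (n Vec.∷ ns) (m Vec.∷ ms) P = begin
  φ (zpow α α⁻¹ n (zpow β β⁻¹ m (g ns ms P)))  ≡⟨ zpow-commute φ φ∘α≗α̃∘φ α∘α⁻¹≗id α̃⁻¹∘α̃≗id n _ ⟩
  zpow α̃ α̃⁻¹ n (φ (zpow β β⁻¹ m (g ns ms P))) ≡⟨ cong (zpow α̃ α̃⁻¹ n) (zpow-commute φ φ∘β≗β̃∘φ β∘β⁻¹≗id β̃⁻¹∘β̃≗id m _) ⟩
  zpow α̃ α̃⁻¹ n (zpow β̃ β̃⁻¹ m (φ (g ns ms P))) ≡⟨ cong (zpow α̃ α̃⁻¹ n ∘ zpow β̃ β̃⁻¹ m) (φ∘g≗g̃∘φ ns ms P) ⟩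
  zpow α̃ α̃⁻¹ n (zpow β̃ β̃⁻¹ m (g̃ ns ms (φ P))) ∎

lemma3p2 : (P : Q5) (t : ℕ) → 1 ≤ t → (ns ms : Vec ℤ t) →
           φ (g ns ms P) ≡ g̃ ns ms (φ P)
lemma3p2 P t _ ns ms = φ∘g≗g̃∘φ ns ms P
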